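{- Let $u$ and $v$ be two distinct vertices in a tournament $T$ with $d^+(u)\ge d^+(v)$. If $u\rightarrow v$, then $s(u,v)\ge |d^+(u)-d^+(v)-1|\ge 0$. If $v\rightarrow u$, then $s(u,v)\ge |d^+(u)-d^+(v)+1|\ge 1$. In particular, if $s(u,v)=0$, then $d^+(u)-d^+(v)=1$ and $u\rightarrow v$.
   Context: $u\rightarrow v$ means $uv$ is an arc of $T$. For distinct vertices $x,y$ of $T$, $p_2(x,y)$ is the number of directed paths of length $2$ from $x$ to $y$, $\pi_2(T)=\min\{p_2(x,y): x\ne y\}$, and the surplus of $\{x,y\}$ is $s(x,y)=p_2(x,y)+p_2(y,x)-2\pi_2(T)$. $d^+$ denotes out-degree in $T$. -}

module Defs where

open import Data.Nat using (ℕ; _+_; _*_; _⊓_)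
open import Data.Bool using (Bool; true; false; not; if_then_else_; _∧_)
open import Data.Fin using (Fin; _≟_)
open import Data.List using (List; []; _∷_; map; foldr; concatMap; allFin)
open import Data.Nat.ListAction using (sum)
open import Data.Integer using (ℤ; +_; _-_)
open import Relation.Nullary using (¬_; yes; no)
open import Relation.Binary.PropositionalEquality using (_≡_)

-- A tournament on the vertex set Fin n: arc x y ≡ true means x → y.
-- No loops, and between two distinct vertices exactly one arc.
record Tournament (n : ℕ) : Set where
  field
    arc        : Fin n → Fin n → Bool
    irrefl     : ∀ x → arc x x ≡ false
    tournament : ∀ x y → ¬ (x ≡ y) → arc y x ≡ not (arc x y)
open Tournament public

count : ∀ {n} → (Fin n → Bool) → ℕ
count {n} P = sum (map (λ z → if P z then 1 else 0) (allFin n))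

outdeg : ∀ {n} → Tournament n → Fin n → ℕ
outdeg T x = count (λ y → arc T x y)

p2 : ∀ {n} → Tournament n → Fin n → Fin n → ℕ
p2 T x y = count (λ z → arc T x z ∧ arc T z y)

p2-values : ∀ {n} → Tournament n → List ℕ
p2-values {n} T =
  concatMap (λ x → concatMap (λ y → pick x y) (allFin n)) (allFin n)
  where
  pick : Fin n → Fin n → List ℕ
  pick x y with x ≟ y
  ... | yes _ = []
  ... | no  _ = p2 T x y ∷ []

-- π₂(T) = min { p₂(x,y) : x ≠ y }.  The fold starts at n, which is an
-- upper bound for every p₂(x,y) (p₂(x,y) ≤ n - 2), so whenever n ≥ 2 this is
-- exactly the minimum.
pi2 : ∀ {n} → Tournament n → ℕ
pi2 {n} T = foldr _⊓_ n (p2-values T)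

surplus : ∀ {n} → Tournament n → Fin n → Fin n → ℤ
surplus T x y = + (p2 T x y + p2 T y x) - + (2 * pi2 T)

-- If x → y, every vertex z contributes equally to d⁺(x) + p₂(y,x) and to
-- p₂(x,y) + d⁺(y), except z = y, which contributes 1 to the left side only
-- (a case check on the arcs between z and x, y).  Hence
-- p₂(x,y) − p₂(y,x) = d⁺(x) − d⁺(y) − 1, and as both p₂(x,y) and p₂(y,x) are at
-- least π₂(T), s(x,y) ≥ |p₂(x,y) − p₂(y,x)|.  This gives both bounds (the second
-- from the arc v → u).  If d⁺(u) ≥ d⁺(v) then |d⁺(u) − d⁺(v) + 1| ≥ 1, so
-- s(u,v) = 0 rules out v → u.
module Submission where

open import Defs
open import Data.Bool using (Bool; true; false; not; if_then_else_; _∧_)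
open import Data.Empty using (⊥-elim)
open import Data.Fin using (Fin; zero; suc; _≟_)
open import Data.Integer using (+_; -_; _-_; _+_; ∣_∣; _≤_; +≤+)
open import Data.Integer.Properties
  using (pos-+; ∣-i∣≡∣i∣; ∣i-j∣≤∣i∣+∣j∣; ∣i∣≡0⇒i≡0; i-j≡0⇒i≡j; drop‿+≤+; [+m]-[+n]≡m⊖n; ⊖-≥)
  renaming (≤-trans to ≤ℤ-trans; ≤-reflexive to ≤ℤ-reflexive)
open import Data.Integer.Tactic.RingSolver using (solve-∀)
open import Data.List using (List; _∷_; map; foldr; concatMap; tabulate; allFin)
open import Data.List.Membership.Propositional using (_∈_; lose)
open import Data.List.Membership.Propositional.Properties using (∈-concatMap⁺; ∈-allFin)
open import Data.List.Relation.Unary.Any using (here; there)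
open import Data.Nat using (ℕ; _≥_)
import Data.Nat as ℕ
import Data.Nat.ListAction as ℕ
import Data.Nat.Properties as ℕ
import Data.Nat.Tactic.RingSolver as ℕ
open import Algebra.Properties.CommutativeMonoid.Sum ℕ.+-0-commutativeMonoid
  using (sum-syntax; ∑-distrib-+; sum-cong-≗; sum-replicate-zero)
open import Data.Product using (_×_; _,_)
open import Function.Base using (_∘_; _∋_)
open import Relation.Nullary using (¬_; does; yes; no; contradiction)
open import Relation.Binary.PropositionalEquality
  using (_≡_; refl; sym; trans; cong; cong₂; subst; subst₂; module ≡-Reasoning)

indicator : Bool → ℕ
indicator b = if b then 1 else 0

sum-map-tabulate : ∀ {A : Set} {n} (g : A → ℕ) (f : Fin n → A) →
  ℕ.sum (map g (tabulate f)) ≡ ∑[ i < n ] g (f i)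
sum-map-tabulate {n = ℕ.zero}  g f = refl
sum-map-tabulate {n = ℕ.suc n} g f = cong (g (f zero) ℕ.+_) (sum-map-tabulate g (f ∘ suc))

count≡∑ : ∀ {n} (P : Fin n → Bool) → count P ≡ ∑[ z < n ] indicator (P z)
count≡∑ P = sum-map-tabulate (indicator ∘ P) (λ z → z)

∑-indicator-≟ : ∀ {n} (y : Fin n) → ∑[ z < n ] indicator (does (z ≟ y)) ≡ 1
∑-indicator-≟ {ℕ.suc n} zero    = cong ℕ.suc (sum-replicate-zero n)
∑-indicator-≟ {ℕ.suc n} (suc y) = ∑-indicator-≟ y

indicator-∧-not-swap : ∀ a b →
  indicator a ℕ.+ indicator (b ∧ not a) ≡ indicator (a ∧ not b) ℕ.+ indicator b
indicator-∧-not-swap true  true  = refl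
indicator-∧-not-swap true  false = refl
indicator-∧-not-swap false true  = refl
indicator-∧-not-swap false false = refl

∈-concatMap-allFin : ∀ {A : Set} {n} (f : Fin n → List A) {a : A} (x : Fin n) →
  a ∈ f x → a ∈ concatMap f (allFin n)
∈-concatMap-allFin f x a∈fx = ∈-concatMap⁺ f (lose (∈-allFin x) a∈fx)

foldr-⊓-≤ : ∀ m {a} (xs : List ℕ) → a ∈ xs → foldr ℕ._⊓_ m xs ℕ.≤ a
foldr-⊓-≤ m (x ∷ xs) (here refl) = ℕ.m⊓n≤m x (foldr ℕ._⊓_ m xs)
foldr-⊓-≤ m (x ∷ xs) (there a∈xs) =
  ℕ.≤-trans (ℕ.m⊓n≤n x (foldr ℕ._⊓_ m xs)) (foldr-⊓-≤ m xs a∈xs)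

∣m-n∣≤m+n-2p : ∀ {p m n} → p ℕ.≤ m → p ℕ.≤ n →
  + ∣ + m - + n ∣ ≤ + (m ℕ.+ n) - + (2 ℕ.* p)
∣m-n∣≤m+n-2p {p} p≤m p≤n with ℕ.m≤n⇒∃[o]m+o≡n p≤m | ℕ.m≤n⇒∃[o]m+o≡n p≤n
... | m′ , refl | n′ , refl =
  subst₂ _≤_ (cong (+_ ∘ ∣_∣) (sym cancel)) (sym excess) (+≤+ (∣i-j∣≤∣i∣+∣j∣ (+ m′) (+ n′)))
  where
  open ≡-Reasoning
  [i+j]-[i+k]≡j-k : ∀ i j k → (i + j) - (i + k) ≡ j - k
  [i+j]-[i+k]≡j-k = solve-∀
  [i+j]-i≡j : ∀ i j → (i + j) - i ≡ j
  [i+j]-i≡j = solve-∀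
  [p+m]+[p+n]≡2p+[m+n] : ∀ p m n → (p ℕ.+ m) ℕ.+ (p ℕ.+ n) ≡ 2 ℕ.* p ℕ.+ (m ℕ.+ n)
  [p+m]+[p+n]≡2p+[m+n] = ℕ.solve-∀
  cancel : + (p ℕ.+ m′) - + (p ℕ.+ n′) ≡ + m′ - + n′
  cancel = begin
    + (p ℕ.+ m′) - + (p ℕ.+ n′) ≡⟨ cong₂ _-_ (pos-+ p m′) (pos-+ p n′) ⟩
    (+ p + + m′) - (+ p + + n′)  ≡⟨ [i+j]-[i+k]≡j-k (+ p) (+ m′) (+ n′) ⟩
    + m′ - + n′                  ∎
  excess : + ((p ℕ.+ m′) ℕ.+ (p ℕ.+ n′)) - + (2 ℕ.* p) ≡ + (m′ ℕ.+ n′)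
  excess = begin
    + ((p ℕ.+ m′) ℕ.+ (p ℕ.+ n′)) - + (2 ℕ.* p)
      ≡⟨ cong (λ k → + k - + (2 ℕ.* p)) ([p+m]+[p+n]≡2p+[m+n] p m′ n′) ⟩
    + (2 ℕ.* p ℕ.+ (m′ ℕ.+ n′)) - + (2 ℕ.* p)
      ≡⟨ cong (_- + (2 ℕ.* p)) (pos-+ (2 ℕ.* p) (m′ ℕ.+ n′)) ⟩
    (+ (2 ℕ.* p) + + (m′ ℕ.+ n′)) - + (2 ℕ.* p)
      ≡⟨ [i+j]-i≡j (+ (2 ℕ.* p)) (+ (m′ ℕ.+ n′)) ⟩
    + (m′ ℕ.+ n′)
      ∎

∣i-j-1∣≡∣j-i+1∣ : ∀ i j → ∣ i - j - + 1 ∣ ≡ ∣ j - i + + 1 ∣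
∣i-j-1∣≡∣j-i+1∣ i j = trans (sym (∣-i∣≡∣i∣ (i - j - + 1))) (cong ∣_∣ (-[i-j-1]≡j-i+1 i j))
  where
  -[i-j-1]≡j-i+1 : ∀ i j → - (i - j - + 1) ≡ j - i + + 1
  -[i-j-1]≡j-i+1 = solve-∀

1≤∣m-n+1∣ : ∀ {m n} → n ℕ.≤ m → + 1 ≤ + ∣ + m - + n + + 1 ∣
1≤∣m-n+1∣ {m} {n} n≤m rewrite [+m]-[+n]≡m⊖n m n | ⊖-≥ n≤m | sym (pos-+ (m ℕ.∸ n) 1) =
  +≤+ (ℕ.m≤n+m 1 (m ℕ.∸ n))

∣i∣≤0⇒i≡0 : ∀ {i} → + ∣ i ∣ ≤ + 0 → i ≡ + 0
∣i∣≤0⇒i≡0 ∣i∣≤0 = ∣i∣≡0⇒i≡0 (ℕ.n≤0⇒n≡0 (drop‿+≤+ ∣i∣≤0))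

m+q≡p+k+1⇒p-q≡m-k-1 : ∀ {m k p q} → m ℕ.+ q ≡ p ℕ.+ k ℕ.+ 1 → + p - + q ≡ + m - + k - + 1
m+q≡p+k+1⇒p-q≡m-k-1 {m} {k} {p} {q} m+q≡p+k+1 = begin
  + p - + q                           ≡⟨ rearrangeˡ (+ p) (+ q) (+ k) ⟩
  (+ p + + k + + 1) - + q - + k - + 1 ≡⟨ cong (λ i → i - + q - + k - + 1) ℤ-form ⟨
  (+ m + + q) - + q - + k - + 1       ≡⟨ rearrangeʳ (+ m) (+ q) (+ k) ⟩
  + m - + k - + 1                     ∎
  where
  open ≡-Reasoning
  rearrangeˡ : ∀ p q k → p - q ≡ (p + k + + 1) - q - k - + 1
  rearrangeˡ = solve-∀
  rearrangeʳ : ∀ m q k → (m + q) - q - k - + 1 ≡ m - k - + 1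
  rearrangeʳ = solve-∀
  ℤ-form : + m + + q ≡ + p + + k + + 1
  ℤ-form = begin
    + m + + q           ≡⟨ pos-+ m q ⟨
    + (m ℕ.+ q)         ≡⟨ cong +_ m+q≡p+k+1 ⟩
    + (p ℕ.+ k ℕ.+ 1)   ≡⟨ pos-+ (p ℕ.+ k) 1 ⟩
    + (p ℕ.+ k) + + 1   ≡⟨ cong (_+ + 1) (pos-+ p k) ⟩
    + p + + k + + 1     ∎

module _ {n} (T : Tournament n) where

  arc⇒indicator-balance : ∀ {x y} → arc T x y ≡ true → ¬ x ≡ y → ∀ z →
    indicator (arc T x z) ℕ.+ indicator (arc T y z ∧ arc T z x)
      ≡ indicator (arc T x z ∧ arc T z y) ℕ.+ indicator (arc T y z) ℕ.+ indicator (does (z ≟ y))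
  arc⇒indicator-balance {x} {y} x→y x≢y z with z ≟ y
  ... | yes refl rewrite x→y | irrefl T z = refl
  ... | no z≢y with z ≟ x
  ...   | yes refl rewrite irrefl T z | tournament T z y z≢y | x→y = refl
  ...   | no z≢x
    rewrite tournament T x z (z≢x ∘ sym) | tournament T y z (z≢y ∘ sym)
          | ℕ.+-identityʳ (indicator (arc T x z ∧ not (arc T y z)) ℕ.+ indicator (arc T y z))
    = indicator-∧-not-swap (arc T x z) (arc T y z)

  arc⇒outdeg+p2≡p2+outdeg+1 : ∀ {x y} → arc T x y ≡ true → ¬ x ≡ y →
    outdeg T x ℕ.+ p2 T y x ≡ p2 T x y ℕ.+ outdeg T y ℕ.+ 1
  arc⇒outdeg+p2≡p2+outdeg+1 {x} {y} x→y x≢y = begin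
    outdeg T x ℕ.+ p2 T y x
      ≡⟨ cong₂ ℕ._+_ (count≡∑ (arc T x)) (count≡∑ (λ z → arc T y z ∧ arc T z x)) ⟩
    ∑[ z < n ] x→z z ℕ.+ ∑[ z < n ] y→z→x z
      ≡⟨ ∑-distrib-+ x→z y→z→x ⟨
    ∑[ z < n ] (x→z z ℕ.+ y→z→x z)
      ≡⟨ sum-cong-≗ (arc⇒indicator-balance x→y x≢y) ⟩
    ∑[ z < n ] (x→z→y z ℕ.+ y→z z ℕ.+ z≡y z)
      ≡⟨ ∑-distrib-+ (λ z → x→z→y z ℕ.+ y→z z) z≡y ⟩
    ∑[ z < n ] (x→z→y z ℕ.+ y→z z) ℕ.+ ∑[ z < n ] z≡y z
      ≡⟨ cong₂ ℕ._+_ (∑-distrib-+ x→z→y y→z) (∑-indicator-≟ y) ⟩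
    ∑[ z < n ] x→z→y z ℕ.+ ∑[ z < n ] y→z z ℕ.+ 1
      ≡⟨ cong (ℕ._+ 1) (cong₂ ℕ._+_ (count≡∑ (λ z → arc T x z ∧ arc T z y)) (count≡∑ (arc T y))) ⟨
    p2 T x y ℕ.+ outdeg T y ℕ.+ 1
      ∎
    where
    open ≡-Reasoning
    x→z y→z→x x→z→y y→z z≡y : Fin n → ℕ
    x→z     z = indicator (arc T x z)
    y→z→x   z = indicator (arc T y z ∧ arc T z x)
    x→z→y   z = indicator (arc T x z ∧ arc T z y)
    y→z     z = indicator (arc T y z)
    z≡y     z = indicator (does (z ≟ y))

  -- The inner list of p2-values is a local with-function on x ≟ y that cannot be named
  -- here; abstracting x ≟ y also in the type of the injection into p2-values exposes it.
  p2∈p2-values : ∀ {x y} → ¬ x ≡ y → p2 T x y ∈ p2-values T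
  p2∈p2-values {x} {y} x≢y
    with x ≟ y | (λ m → p2 T x y ∈ p2-values T ∋ ∈-concatMap-allFin _ x (∈-concatMap-allFin _ y m))
  ... | yes x≡y | _    = ⊥-elim (x≢y x≡y)
  ... | no _    | into = into (here refl)

  pi2≤p2 : ∀ {x y} → ¬ x ≡ y → pi2 T ℕ.≤ p2 T x y
  pi2≤p2 x≢y = foldr-⊓-≤ n (p2-values T) (p2∈p2-values x≢y)

  ∣p2-p2∣≤surplus : ∀ {x y} → ¬ x ≡ y → + ∣ + p2 T x y - + p2 T y x ∣ ≤ surplus T x y
  ∣p2-p2∣≤surplus x≢y = ∣m-n∣≤m+n-2p (pi2≤p2 x≢y) (pi2≤p2 (x≢y ∘ sym))

  surplus-comm : ∀ x y → surplus T x y ≡ surplus T y x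
  surplus-comm x y = cong (λ k → + k - + (2 ℕ.* pi2 T)) (ℕ.+-comm (p2 T x y) (p2 T y x))

  arc⇒∣outdeg-outdeg-1∣≤surplus : ∀ {x y} → arc T x y ≡ true → ¬ x ≡ y →
    + ∣ + outdeg T x - + outdeg T y - + 1 ∣ ≤ surplus T x y
  arc⇒∣outdeg-outdeg-1∣≤surplus {x} {y} x→y x≢y =
    subst (λ i → + ∣ i ∣ ≤ surplus T x y) p2-p2≡outdeg-outdeg-1 (∣p2-p2∣≤surplus x≢y)
    where
    p2-p2≡outdeg-outdeg-1 : + p2 T x y - + p2 T y x ≡ + outdeg T x - + outdeg T y - + 1
    p2-p2≡outdeg-outdeg-1 =
      m+q≡p+k+1⇒p-q≡m-k-1 {outdeg T x} {outdeg T y} (arc⇒outdeg+p2≡p2+outdeg+1 x→y x≢y)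

lemma2 : ∀ {n} (T : Tournament n) (u v : Fin n) → ¬ (u ≡ v) →
    outdeg T u ≥ outdeg T v →
    (arc T u v ≡ true →
      (+ ∣ + outdeg T u - + outdeg T v - + 1 ∣ ≤ surplus T u v)
      × (+ 0 ≤ + ∣ + outdeg T u - + outdeg T v - + 1 ∣))
    × (arc T v u ≡ true →
      (+ ∣ + outdeg T u - + outdeg T v + + 1 ∣ ≤ surplus T u v)
      × (+ 1 ≤ + ∣ + outdeg T u - + outdeg T v + + 1 ∣))
    × (surplus T u v ≡ + 0 →
      (+ outdeg T u - + outdeg T v ≡ + 1) × (arc T u v ≡ true))
lemma2 T u v u≢v du≥dv =
    (λ u→v → forward u→v , +≤+ ℕ.z≤n)
  , (λ v→u → backward v→u , 1≤∣m-n+1∣ du≥dv)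
  , zero-surplus
  where
  forward : arc T u v ≡ true → + ∣ + outdeg T u - + outdeg T v - + 1 ∣ ≤ surplus T u v
  forward u→v = arc⇒∣outdeg-outdeg-1∣≤surplus T u→v u≢v
  backward : arc T v u ≡ true → + ∣ + outdeg T u - + outdeg T v + + 1 ∣ ≤ surplus T u v
  backward v→u =
    subst₂ _≤_ (cong +_ (∣i-j-1∣≡∣j-i+1∣ (+ outdeg T v) (+ outdeg T u))) (surplus-comm T v u)
      (arc⇒∣outdeg-outdeg-1∣≤surplus T v→u (u≢v ∘ sym))
  zero-surplus : surplus T u v ≡ + 0 → (+ outdeg T u - + outdeg T v ≡ + 1) × (arc T u v ≡ true)
  zero-surplus s≡0 with arc T u v in u→v
  ... | true  = i-j≡0⇒i≡j _ (+ 1) (∣i∣≤0⇒i≡0 (≤ℤ-trans (forward u→v) (≤ℤ-reflexive s≡0))) , refl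
  ... | false = contradiction (drop‿+≤+ 1≤0) λ ()
    where
    v→u : arc T v u ≡ true
    v→u = trans (tournament T u v u≢v) (cong not u→v)
    1≤0 : + 1 ≤ + 0
    1≤0 = ≤ℤ-trans (1≤∣m-n+1∣ du≥dv) (≤ℤ-trans (backward v→u) (≤ℤ-reflexive s≡0))
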